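{- Let $\mathcal B,\mathcal B_1,\mathcal B_2\subseteq\mathcal P([n])$ be simply rooted families with $\mathcal B_1\cup\mathcal B_2=\mathcal B$, and let $b$ be the number of bad sets of $\mathcal B$. Then \[ |d(\mathcal B_1)\cap d(\mathcal B_2)|\le b+|\mathcal B_1\cap\mathcal B_2|. \]
   Context: A family $\mathcal F$ is simply rooted if for every nonempty $F\in\mathcal F$ there is $b\in F$ with $\{C:\{b\}\subseteq C\subseteq F\}\subseteq\mathcal F$. For $\mathcal F\subseteq\mathcal P([n])$ and $i\in[n]$: $d_{(i,\mathcal F)}(F)=F\setminus\{i\}$ if $i\in F$ and $F\setminus\{i\}\notin\mathcal F$, else $F$; $d_i(\mathcal F)=\{d_{(i,\mathcal F)}(F):F\in\mathcal F\}$. With $\mathcal F_0=\mathcal F$, $\mathcal F_k=d_k(\mathcal F_{k-1})$, set $d(\mathcal F)=\mathcal F_n$ and $d_{\mathcal F}(F)=d_{(n,\mathcal F_{n-1})}\circ\cdots\circ d_{(1,\mathcal F_0)}(F)$ for $F\in\mathcal F$. For a finite set $B$, $\delta B=\{B\setminus\{i\}:i\in B\}$. A set $B\in\mathcal B$ is a bad set of $\mathcal B$ if $\delta B\subseteq\mathcal B$ or $d_{\mathcal B}(B)=B$. -}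

module Defs where

open import Data.Nat using (ℕ; zero; suc; _+_)
open import Data.Bool using (Bool; true; false; _∧_; _∨_; not; if_then_else_; T)
open import Data.Bool.Properties using (T?)
open import Data.Fin using (Fin)
open import Data.Fin.Subset using (Subset; inside; outside; _∈_; _⊆_; ⁅_⁆; _-_; Nonempty)
open import Data.Fin.Subset.Properties using (_∈?_)
open import Data.Fin.Properties using (all?)
open import Data.List using (List; []; _∷_; [_]; _++_; map; length; filter; allFin)
open import Data.Bool.ListAction using (any)
open import Data.Vec using (Vec; lookup) renaming ([] to []ᵥ; _∷_ to _∷ᵥ_)
open import Data.Vec.Properties using (≡-dec)
open import Data.Product using (∃-syntax; _×_)
open import Data.Sum using (_⊎_)
open import Relation.Nullary using (Dec; _→-dec_; _⊎-dec_; _×-dec_)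
open import Relation.Nullary.Decidable using (⌊_⌋)
open import Relation.Binary.PropositionalEquality using (_≡_)
import Data.Bool as B

-- A family of subsets of [n] = {0,…,n-1} (Fin n), given by its
-- characteristic function on the power set.
Family : ℕ → Set
Family n = Subset n → Bool

_≟ˢ_ : ∀ {n} (x y : Subset n) → Dec (x ≡ y)
_≟ˢ_ = ≡-dec B._≟_

allSubsets : (n : ℕ) → List (Subset n)
allSubsets zero = [ []ᵥ ]
allSubsets (suc n) = map (outside ∷ᵥ_) (allSubsets n) ++ map (inside ∷ᵥ_) (allSubsets n)

card : ∀ {n} → Family n → ℕ
card {n} 𝓕 = length (filter (λ S → T? (𝓕 S)) (allSubsets n))

_∩ᶠ_ : ∀ {n} → Family n → Family n → Family n
(𝓐 ∩ᶠ 𝓑) S = 𝓐 S ∧ 𝓑 S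

SimplyRooted : ∀ {n} → Family n → Set
SimplyRooted 𝓕 = ∀ F → T (𝓕 F) → Nonempty F →
  ∃[ b ] (b ∈ F × (∀ C → ⁅ b ⁆ ⊆ C → C ⊆ F → T (𝓕 C)))

dElt : ∀ {n} → Fin n → Family n → Subset n → Subset n
dElt i 𝓕 F = if lookup F i ∧ not (𝓕 (F - i)) then F - i else F

dFam : ∀ {n} → Fin n → Family n → Family n
dFam {n} i 𝓕 G = any (λ F → 𝓕 F ∧ ⌊ dElt i 𝓕 F ≟ˢ G ⌋) (allSubsets n)

dFamSeq : ∀ {n} → List (Fin n) → Family n → Family n
dFamSeq [] 𝓕 = 𝓕
dFamSeq (i ∷ is) 𝓕 = dFamSeq is (dFam i 𝓕)

dEltSeq : ∀ {n} → List (Fin n) → Family n → Subset n → Subset n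
dEltSeq [] 𝓕 F = F
dEltSeq (i ∷ is) 𝓕 F = dEltSeq is (dFam i 𝓕) (dElt i 𝓕 F)

-- d(𝓕) = 𝓕_n, compressing in the order 1,…,n (here 0,…,n-1)
d : ∀ {n} → Family n → Family n
d {n} 𝓕 = dFamSeq (allFin n) 𝓕

d[_] : ∀ {n} → Family n → Subset n → Subset n
d[_] {n} 𝓕 F = dEltSeq (allFin n) 𝓕 F

δ⊆ : ∀ {n} → Subset n → Family n → Set
δ⊆ B 𝓑 = ∀ i → i ∈ B → T (𝓑 (B - i))

BadSet : ∀ {n} → Family n → Subset n → Set
BadSet 𝓑 B = T (𝓑 B) × (δ⊆ B 𝓑 ⊎ d[ 𝓑 ] B ≡ B)

badSet? : ∀ {n} (𝓑 : Family n) (B : Subset n) → Dec (BadSet 𝓑 B)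
badSet? 𝓑 B = T? (𝓑 B) ×-dec (all? (λ i → (i ∈? B) →-dec T? (𝓑 (B - i))) ⊎-dec (d[ 𝓑 ] B ≟ˢ B))

numBad : ∀ {n} → Family n → ℕ
numBad {n} 𝓑 = length (filter (badSet? 𝓑) (allSubsets n))

module Submission where

-- Compressions do not enlarge families, so inclusion–exclusion gives
--   |d𝓑₁ ∪ d𝓑₂| + |d𝓑₁ ∩ d𝓑₂| ≤ |𝓑₁| + |𝓑₂| = |𝓑| + |𝓑₁ ∩ 𝓑₂|,
-- and it suffices to inject the good (non-bad) sets of 𝓑 into d𝓑₁ ∪ d𝓑₂.
-- The injection is d_𝓑 itself.  For a good S ∈ 𝓑ⱼ pick z ∈ S with
-- S ∖ {z} ∉ 𝓑; then [{z}, S] ⊆ 𝓑ⱼ, and the stability lemma shows that along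
-- the compressions S is either never moved in 𝓑 (excluded, S being good) or
-- sent to the same set in 𝓑 and 𝓑ⱼ, so d_𝓑(S) = d_𝓑ⱼ(S) ∈ d(𝓑ⱼ).

open import Defs
open import Data.Nat using (ℕ; zero; suc; _≤_; _+_; z≤n; s≤s)
open import Data.Nat.Properties
  using (≤-refl; ≤-trans; ≤-reflexive; +-suc; +-comm; +-assoc; +-cancelˡ-≤; +-mono-≤; +-monoˡ-≤; +-monoʳ-≤; module ≤-Reasoning)
open import Data.Bool using (Bool; true; false; _∧_; _∨_; not; if_then_else_; T)
open import Data.Bool.Properties using (T?; T-∧; T-∨)
open import Data.Unit using (tt)
open import Data.Empty using (⊥-elim)
open import Data.Fin using (Fin; zero; suc)
open import Data.Fin.Properties using (_≟_; ¬∀⟶∃¬)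
open import Data.Fin.Subset using (Subset; _∈_; _∉_; _⊆_; ⁅_⁆; _-_; _∪_; Nonempty)
open import Data.Fin.Subset.Properties
  using (_∈?_; drop-there; ⊆-trans; ⊆-antisym; p─q⊆p; x∈p∧x≢y⇒x∈p-y; x∈⁅x⁆; x∈⁅y⁆⇒x≡y; p⊆p∪q; q⊆p∪q; x∈p∪q⁻; nonempty?; Empty-unique)
open import Data.Vec using (lookup) renaming ([] to []ᵥ; _∷_ to _∷ᵥ_)
open import Data.Vec.Properties using ([]=⇒lookup; lookup⇒[]=; ∷-injectiveʳ)
open import Data.List using (List; []; _∷_; [_]; _++_; map; length; filter; allFin)
open import Data.List.Properties using (length-++; length-map)
open import Data.List.Membership.Propositional using () renaming (_∈_ to _∈ₗ_)
open import Data.List.Membership.Propositional.Properties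
  using (∈-map⁺; ∈-map⁻; ∈-++⁺ˡ; ∈-++⁺ʳ; ∈-++⁻; ∈-∃++; ∈-filter⁺; ∈-filter⁻)
open import Data.List.Relation.Unary.Any as Any using ()
open import Data.List.Relation.Unary.Any.Properties using (any⁺; any⁻)
open import Data.List.Relation.Unary.All as All using ([])
open import Data.List.Relation.Unary.AllPairs using ([]; _∷_)
open import Data.List.Relation.Unary.Unique.Propositional using (Unique)
import Data.List.Relation.Unary.Unique.Propositional.Properties as Unique
open import Data.Product using (∃-syntax; _×_; _,_; proj₁; proj₂)
open import Data.Sum using (_⊎_; inj₁; inj₂)
open import Relation.Nullary using (¬_; Dec; yes; no; _×-dec_; ¬?; _→-dec_)
open import Relation.Nullary.Decidable using (toWitness; fromWitness)
open import Level using (0ℓ)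
open import Relation.Unary using (Pred; Decidable)
open import Relation.Binary.PropositionalEquality
  using (_≡_; _≢_; refl; sym; trans; cong; subst; module ≡-Reasoning)
open import Function.Bundles using (Equivalence)
open Equivalence using (to; from)

∉-removed : ∀ {n} (p : Subset n) (i : Fin n) → i ∉ p - i
∉-removed (_ ∷ᵥ p) zero    ()
∉-removed (_ ∷ᵥ p) (suc i) i∈p-i = ∉-removed p i (drop-there i∈p-i)

module _ {n : ℕ} where

  removed-≢ : ∀ {p : Subset n} {i x} → x ∈ p - i → x ≢ i
  removed-≢ {p} {i} x∈p-i refl = ∉-removed p i x∈p-i

  remove-⊆ : (p : Subset n) (i : Fin n) → p - i ⊆ p
  remove-⊆ p i = p─q⊆p p ⁅ i ⁆

  remove-mono : ∀ {C S : Subset n} i → C ⊆ S → C - i ⊆ S - i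
  remove-mono {C} i C⊆S x∈C-i = x∈p∧x≢y⇒x∈p-y (C⊆S (remove-⊆ C i x∈C-i)) (removed-≢ x∈C-i)

  ⊆-remove : ∀ {C S : Subset n} {i} → C ⊆ S → i ∉ C → C ⊆ S - i
  ⊆-remove C⊆S i∉C x∈C = x∈p∧x≢y⇒x∈p-y (C⊆S x∈C) (λ { refl → i∉C x∈C })

  remove-injective : ∀ {X Y : Subset n} i → i ∈ X → i ∈ Y → X - i ≡ Y - i → X ≡ Y
  remove-injective {X} {Y} i i∈X i∈Y eq = ⊆-antisym (half i∈Y eq) (half i∈X (sym eq))
    where
    half : ∀ {P Q} → i ∈ Q → P - i ≡ Q - i → P ⊆ Q
    half {P} {Q} i∈Q eq′ {x} x∈P with x ≟ i
    ... | yes refl = i∈Q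
    ... | no  x≢i  = remove-⊆ Q i (subst (x ∈_) eq′ (x∈p∧x≢y⇒x∈p-y x∈P x≢i))

  insert-remove : ∀ (C : Subset n) i → i ∉ C → (C ∪ ⁅ i ⁆) - i ≡ C
  insert-remove C i i∉C = ⊆-antisym ⊆C C⊆
    where
    ⊆C : (C ∪ ⁅ i ⁆) - i ⊆ C
    ⊆C x∈ with x∈p∪q⁻ C ⁅ i ⁆ (remove-⊆ (C ∪ ⁅ i ⁆) i x∈)
    ... | inj₁ x∈C = x∈C
    ... | inj₂ x∈i = ⊥-elim (removed-≢ x∈ (x∈⁅y⁆⇒x≡y i x∈i))
    C⊆ : C ⊆ (C ∪ ⁅ i ⁆) - i
    C⊆ x∈C = x∈p∧x≢y⇒x∈p-y (p⊆p∪q ⁅ i ⁆ x∈C) (λ { refl → i∉C x∈C })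

  ⊆-removed⇒∉ : ∀ {C S : Subset n} {i} → C ⊆ S - i → i ∉ C
  ⊆-removed⇒∉ {S = S} {i} C⊆S-i i∈C = ∉-removed S i (C⊆S-i i∈C)

  insert-⊆ : ∀ {C S : Subset n} {i} → C ⊆ S - i → i ∈ S → C ∪ ⁅ i ⁆ ⊆ S
  insert-⊆ {C} {S} {i} C⊆S-i i∈S x∈ with x∈p∪q⁻ C ⁅ i ⁆ x∈
  ... | inj₁ x∈C = remove-⊆ S i (C⊆S-i x∈C)
  ... | inj₂ x∈i rewrite x∈⁅y⁆⇒x≡y i x∈i = i∈S

  ⁅⁆⊆⇒∈ : ∀ {C : Subset n} {b} → ⁅ b ⁆ ⊆ C → b ∈ C
  ⁅⁆⊆⇒∈ {b = b} b⊆C = b⊆C (x∈⁅x⁆ b)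

  ∈⇒⁅⁆⊆ : ∀ {C : Subset n} {b} → b ∈ C → ⁅ b ⁆ ⊆ C
  ∈⇒⁅⁆⊆ {b = b} b∈C x∈b rewrite x∈⁅y⁆⇒x≡y b x∈b = b∈C

  lookup-true : ∀ {S : Subset n} {i} → lookup S i ≡ true → i ∈ S
  lookup-true {S} {i} = lookup⇒[]= i S

  lookup-false : ∀ {S : Subset n} {i} → lookup S i ≡ false → i ∉ S
  lookup-false e i∈S with trans (sym ([]=⇒lookup i∈S)) e
  ... | ()

module _ {A : Set} where

  -- Proved by deleting the head of xs from ys and recursing.
  unique-⊆⇒length≤ : (xs ys : List A) → Unique xs → (∀ {x} → x ∈ₗ xs → x ∈ₗ ys) →
    length xs ≤ length ys
  unique-⊆⇒length≤ [] ys _ _ = z≤n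
  unique-⊆⇒length≤ (x ∷ xs) ys (x∉xs ∷ xs-unique) xs⊆ys with ∈-∃++ (xs⊆ys (Any.here refl))
  ... | us , vs , refl =
    ≤-trans (s≤s (unique-⊆⇒length≤ xs (us ++ vs) xs-unique xs⊆us++vs)) (≤-reflexive (sym length-split))
    where
    -- every y ∈ xs differs from x, so it survives deleting x from ys
    xs⊆us++vs : ∀ {y} → y ∈ₗ xs → y ∈ₗ us ++ vs
    xs⊆us++vs {y} y∈xs with ∈-++⁻ us (xs⊆ys (Any.there y∈xs))
    ... | inj₁ y∈us            = ∈-++⁺ˡ y∈us
    ... | inj₂ (Any.here refl) = ⊥-elim (All.lookup x∉xs y∈xs refl)
    ... | inj₂ (Any.there y∈vs) = ∈-++⁺ʳ us y∈vs
    length-split : length (us ++ [ x ] ++ vs) ≡ suc (length (us ++ vs))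
    length-split = begin
      length (us ++ [ x ] ++ vs)      ≡⟨ length-++ us ⟩
      length us + suc (length vs)     ≡⟨ +-suc (length us) (length vs) ⟩
      suc (length us + length vs)     ≡⟨ cong suc (sym (length-++ us)) ⟩
      suc (length (us ++ vs))         ∎
      where open ≡-Reasoning

module _ {A B : Set} (f : A → B) where

  InjectiveOn : List A → Set
  InjectiveOn xs = ∀ {a a′} → a ∈ₗ xs → a′ ∈ₗ xs → f a ≡ f a′ → a ≡ a′

  map-unique : (xs : List A) → Unique xs → InjectiveOn xs → Unique (map f xs)
  map-unique [] _ _ = []
  map-unique (x ∷ xs) (x∉xs ∷ xs-unique) f-inj =
    All.tabulate fx∉ ∷ map-unique xs xs-unique (λ a∈ a′∈ → f-inj (Any.there a∈) (Any.there a′∈))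
    where
    fx∉ : ∀ {y} → y ∈ₗ map f xs → f x ≢ y
    fx∉ y∈ fx≡y with ∈-map⁻ f y∈
    ... | a , a∈xs , refl = All.lookup x∉xs a∈xs (f-inj (Any.here refl) (Any.there a∈xs) fx≡y)

  injection⇒length≤ : (xs : List A) (ys : List B) → Unique xs → InjectiveOn xs →
    (∀ {a} → a ∈ₗ xs → f a ∈ₗ ys) → length xs ≤ length ys
  injection⇒length≤ xs ys xs-unique f-inj into = begin
    length xs          ≡⟨ length-map f xs ⟨
    length (map f xs)  ≤⟨ unique-⊆⇒length≤ (map f xs) ys (map-unique xs xs-unique f-inj) image⊆ys ⟩
    length ys          ∎
    where
    open ≤-Reasoning
    image⊆ys : ∀ {y} → y ∈ₗ map f xs → y ∈ₗ ys
    image⊆ys y∈ with ∈-map⁻ f y∈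
    ... | a , a∈xs , refl = into a∈xs

  surjection⇒length≤ : (xs : List A) (ys : List B) → Unique ys →
    (∀ {b} → b ∈ₗ ys → ∃[ a ] (a ∈ₗ xs × f a ≡ b)) → length ys ≤ length xs
  surjection⇒length≤ xs ys ys-unique onto = begin
    length ys          ≤⟨ unique-⊆⇒length≤ ys (map f xs) ys-unique ys⊆image ⟩
    length (map f xs)  ≡⟨ length-map f xs ⟩
    length xs          ∎
    where
    open ≤-Reasoning
    ys⊆image : ∀ {y} → y ∈ₗ ys → y ∈ₗ map f xs
    ys⊆image y∈ with onto y∈
    ... | a , a∈xs , refl = ∈-map⁺ f a∈xs

module _ {A : Set} where

  count : (A → Bool) → List A → ℕ
  count f xs = length (filter (λ x → T? (f x)) xs)

  count-∨-∧ : (f g : A → Bool) (xs : List A) →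
    count (λ x → f x ∨ g x) xs + count (λ x → f x ∧ g x) xs ≡ count f xs + count g xs
  count-∨-∧ f g [] = refl
  count-∨-∧ f g (x ∷ xs) with f x | g x
  ... | true  | true  = cong suc (trans (+-suc _ _) (trans (cong suc (count-∨-∧ f g xs)) (sym (+-suc _ _))))
  ... | true  | false = cong suc (count-∨-∧ f g xs)
  ... | false | true  = trans (cong suc (count-∨-∧ f g xs)) (sym (+-suc _ _))
  ... | false | false = count-∨-∧ f g xs

  count-cong : (f g : A → Bool) (xs : List A) → (∀ x → f x ≡ g x) → count f xs ≡ count g xs
  count-cong f g [] _ = refl
  count-cong f g (x ∷ xs) f≗g with f x | g x | f≗g x
  ... | true  | .true  | refl = cong suc (count-cong f g xs f≗g)
  ... | false | .false | refl = count-cong f g xs f≗g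

  count-split : (f : A → Bool) {P : Pred A 0ℓ} (P? : Decidable P) → (∀ x → P x → T (f x)) →
    (xs : List A) →
    count f xs ≡ length (filter P? xs) + length (filter (λ x → T? (f x) ×-dec ¬? (P? x)) xs)
  count-split f P? P⇒f [] = refl
  count-split f P? P⇒f (x ∷ xs) with f x in fx | P? x
  ... | true  | yes _ = cong suc (count-split f P? P⇒f xs)
  ... | true  | no  _ = trans (cong suc (count-split f P? P⇒f xs)) (sym (+-suc _ _))
  ... | false | yes p = ⊥-elim (subst T fx (P⇒f x p))
  ... | false | no  _ = count-split f P? P⇒f xs

allSubsets-complete : ∀ {n} (S : Subset n) → S ∈ₗ allSubsets n
allSubsets-complete []ᵥ = Any.here refl
allSubsets-complete {suc n} (false ∷ᵥ S) =
  ∈-++⁺ˡ (∈-map⁺ (false ∷ᵥ_) (allSubsets-complete S))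
allSubsets-complete {suc n} (true ∷ᵥ S) =
  ∈-++⁺ʳ (map (false ∷ᵥ_) (allSubsets n)) (∈-map⁺ (true ∷ᵥ_) (allSubsets-complete S))

allSubsets-unique : ∀ n → Unique (allSubsets n)
allSubsets-unique zero = [] ∷ []
allSubsets-unique (suc n) =
  Unique.++⁺ (Unique.map⁺ ∷-injectiveʳ (allSubsets-unique n))
             (Unique.map⁺ ∷-injectiveʳ (allSubsets-unique n)) disjoint
  where
  disjoint : ∀ {S} → ¬ (S ∈ₗ map (false ∷ᵥ_) (allSubsets n) × S ∈ₗ map (true ∷ᵥ_) (allSubsets n))
  disjoint (S∈₀ , S∈₁) with ∈-map⁻ (false ∷ᵥ_) S∈₀ | ∈-map⁻ (true ∷ᵥ_) S∈₁
  ... | _ , _ , refl | _ , _ , ()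

module _ {n : ℕ} where

  infix 4 _∈ᶠ_
  _∈ᶠ_ : Subset n → Family n → Set
  S ∈ᶠ 𝓕 = T (𝓕 S)

  dElt-unfold : ∀ i 𝓕 (S : Subset n) {a b} → lookup S i ≡ a → 𝓕 (S - i) ≡ b →
    dElt i 𝓕 S ≡ (if a ∧ not b then S - i else S)
  dElt-unfold i 𝓕 S refl refl = refl

  data StepView (i : Fin n) (𝓕 : Family n) (S : Subset n) : Set where
    stays : (i ∈ S → S - i ∈ᶠ 𝓕) → dElt i 𝓕 S ≡ S → StepView i 𝓕 S
    drops : i ∈ S → ¬ (S - i ∈ᶠ 𝓕) → dElt i 𝓕 S ≡ S - i → StepView i 𝓕 S

  stepView : ∀ i 𝓕 S → StepView i 𝓕 S
  stepView i 𝓕 S with lookup S i in i∈S? | 𝓕 (S - i) in S-i∈𝓕?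
  ... | true  | true  = stays (λ _ → subst T (sym S-i∈𝓕?) tt) (dElt-unfold i 𝓕 S i∈S? S-i∈𝓕?)
  ... | true  | false = drops (lookup-true i∈S?) (subst T S-i∈𝓕?) (dElt-unfold i 𝓕 S i∈S? S-i∈𝓕?)
  ... | false | _     = stays (λ i∈S → ⊥-elim (lookup-false i∈S? i∈S)) (dElt-unfold i 𝓕 S i∈S? S-i∈𝓕?)

  stays-put : ∀ i 𝓕 S → (i ∈ S → S - i ∈ᶠ 𝓕) → dElt i 𝓕 S ≡ S
  stays-put i 𝓕 S keep with stepView i 𝓕 S
  ... | stays _ eq       = eq
  ... | drops i∈S S-i∉ _ = ⊥-elim (S-i∉ (keep i∈S))

  drops-i : ∀ i 𝓕 S → i ∈ S → ¬ (S - i ∈ᶠ 𝓕) → dElt i 𝓕 S ≡ S - i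
  drops-i i 𝓕 S i∈S S-i∉ with stepView i 𝓕 S
  ... | stays keep _ = ⊥-elim (S-i∉ (keep i∈S))
  ... | drops _ _ eq = eq

  dFam-intro : ∀ i 𝓕 S → S ∈ᶠ 𝓕 → dElt i 𝓕 S ∈ᶠ dFam i 𝓕
  dFam-intro i 𝓕 S S∈𝓕 =
    any⁺ _ (Any.map (λ { refl → from T-∧ (S∈𝓕 , fromWitness refl) }) (allSubsets-complete S))

  dFam-elim : ∀ i 𝓕 G → G ∈ᶠ dFam i 𝓕 → ∃[ S ] (S ∈ᶠ 𝓕 × dElt i 𝓕 S ≡ G)
  dFam-elim i 𝓕 G G∈ with Any.satisfied (any⁻ _ (allSubsets n) G∈)
  ... | S , found with to T-∧ found
  ... | S∈𝓕 , S↦G = S , S∈𝓕 , toWitness S↦G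

  stays-in : ∀ i 𝓕 S → S ∈ᶠ 𝓕 → (i ∈ S → S - i ∈ᶠ 𝓕) → S ∈ᶠ dFam i 𝓕
  stays-in i 𝓕 S S∈𝓕 keep = subst (_∈ᶠ dFam i 𝓕) (stays-put i 𝓕 S keep) (dFam-intro i 𝓕 S S∈𝓕)

  -- d_(i,𝓕) is injective on 𝓕: a moved set never lands on an old member.
  dElt-injective : ∀ i 𝓕 X Y → X ∈ᶠ 𝓕 → Y ∈ᶠ 𝓕 → dElt i 𝓕 X ≡ dElt i 𝓕 Y → X ≡ Y
  dElt-injective i 𝓕 X Y X∈ Y∈ eq with stepView i 𝓕 X | stepView i 𝓕 Y
  ... | stays _ X↦X         | stays _ Y↦Y         = trans (sym X↦X) (trans eq Y↦Y)
  ... | stays _ X↦X         | drops _ Y-i∉ Y↦Y-i  =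
    ⊥-elim (Y-i∉ (subst (_∈ᶠ 𝓕) (trans (sym X↦X) (trans eq Y↦Y-i)) X∈))
  ... | drops _ X-i∉ X↦X-i  | stays _ Y↦Y         =
    ⊥-elim (X-i∉ (subst (_∈ᶠ 𝓕) (trans (sym Y↦Y) (trans (sym eq) X↦X-i)) Y∈))
  ... | drops i∈X _ X↦X-i   | drops i∈Y _ Y↦Y-i   =
    remove-injective i i∈X i∈Y (trans (sym X↦X-i) (trans eq Y↦Y-i))

module _ {n : ℕ} where

  Below : Family n → Subset n → Set
  Below 𝓕 S = ∀ C → C ⊆ S → C ∈ᶠ 𝓕

  Interval : Family n → Fin n → Subset n → Set
  Interval 𝓕 b S = ∀ C → ⁅ b ⁆ ⊆ C → C ⊆ S → C ∈ᶠ 𝓕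

  infix 4 _⊆ᶠ_
  _⊆ᶠ_ : Family n → Family n → Set
  𝓕₁ ⊆ᶠ 𝓕 = ∀ S → S ∈ᶠ 𝓕₁ → S ∈ᶠ 𝓕

  below-step : ∀ i 𝓕 S → Below 𝓕 S → Below (dFam i 𝓕) S
  below-step i 𝓕 S below C C⊆S =
    stays-in i 𝓕 C (below C C⊆S) (λ _ → below (C - i) (⊆-trans (remove-⊆ C i) C⊆S))

  interval-step : ∀ i z 𝓕 S → i ≢ z → Interval 𝓕 z S → Interval (dFam i 𝓕) z S
  interval-step i z 𝓕 S i≢z interval C z⊆C C⊆S =
    stays-in i 𝓕 C (interval C z⊆C C⊆S) (λ _ → interval (C - i) z⊆C-i (⊆-trans (remove-⊆ C i) C⊆S))
    where
    z⊆C-i : ⁅ z ⁆ ⊆ C - i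
    z⊆C-i = ∈⇒⁅⁆⊆ (x∈p∧x≢y⇒x∈p-y (⁅⁆⊆⇒∈ z⊆C) (λ z≡i → i≢z (sym z≡i)))

  -- If [{i}, S] lies in 𝓕, then after d_i the whole power set of S ∖ {i} does:
  -- each C ⊆ S ∖ {i} is either already in 𝓕 or is the image of C ∪ {i}.
  interval-below-step : ∀ i 𝓕 S → i ∈ S → Interval 𝓕 i S → Below (dFam i 𝓕) (S - i)
  interval-below-step i 𝓕 S i∈S interval C C⊆S-i with T? (𝓕 C)
  ... | yes C∈𝓕 = stays-in i 𝓕 C C∈𝓕 (λ i∈C → ⊥-elim (⊆-removed⇒∉ C⊆S-i i∈C))
  ... | no  C∉𝓕 = subst (_∈ᶠ dFam i 𝓕) C+i↦C (dFam-intro i 𝓕 (C ∪ ⁅ i ⁆) C+i∈𝓕)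
    where
    C+i-i≡C : (C ∪ ⁅ i ⁆) - i ≡ C
    C+i-i≡C = insert-remove C i (⊆-removed⇒∉ C⊆S-i)
    C+i∈𝓕 : C ∪ ⁅ i ⁆ ∈ᶠ 𝓕
    C+i∈𝓕 = interval (C ∪ ⁅ i ⁆) (q⊆p∪q C ⁅ i ⁆) (insert-⊆ C⊆S-i i∈S)
    C+i↦C : dElt i 𝓕 (C ∪ ⁅ i ⁆) ≡ C
    C+i↦C = trans (drops-i i 𝓕 (C ∪ ⁅ i ⁆) (q⊆p∪q C ⁅ i ⁆ (x∈⁅x⁆ i))
                            (subst (λ X → ¬ (X ∈ᶠ 𝓕)) (sym C+i-i≡C) C∉𝓕))
                  C+i-i≡C

  ⊆ᶠ-step : ∀ i 𝓕₁ 𝓕 → 𝓕₁ ⊆ᶠ 𝓕 → dFam i 𝓕₁ ⊆ᶠ dFam i 𝓕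
  ⊆ᶠ-step i 𝓕₁ 𝓕 𝓕₁⊆𝓕 G G∈ with dFam-elim i 𝓕₁ G G∈
  ... | U , U∈𝓕₁ , refl with stepView i 𝓕₁ U
  ... | stays keep U↦U =
    subst (_∈ᶠ dFam i 𝓕) (sym U↦U) (stays-in i 𝓕 U (𝓕₁⊆𝓕 U U∈𝓕₁) (λ i∈U → 𝓕₁⊆𝓕 (U - i) (keep i∈U)))
  ... | drops i∈U _ U↦U-i with T? (𝓕 (U - i))
  ...   | yes U-i∈𝓕 =
    subst (_∈ᶠ dFam i 𝓕) (sym U↦U-i) (stays-in i 𝓕 (U - i) U-i∈𝓕 (λ i∈U-i → ⊥-elim (∉-removed U i i∈U-i)))
  ...   | no  U-i∉𝓕 =
    subst (_∈ᶠ dFam i 𝓕) (trans (drops-i i 𝓕 U i∈U U-i∉𝓕) (sym U↦U-i)) (dFam-intro i 𝓕 U (𝓕₁⊆𝓕 U U∈𝓕₁))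

  dropped-root : ∀ 𝓕 U i → SimplyRooted 𝓕 → U ∈ᶠ 𝓕 → i ∈ U → ¬ (U - i ∈ᶠ 𝓕) → Interval 𝓕 i U
  dropped-root 𝓕 U i rooted U∈𝓕 i∈U U-i∉𝓕 with rooted U U∈𝓕 (i , i∈U)
  ... | b , b∈U , interval with b ≟ i
  ...   | yes refl = interval
  ...   | no  b≢i  =
    ⊥-elim (U-i∉𝓕 (interval (U - i) (∈⇒⁅⁆⊆ (x∈p∧x≢y⇒x∈p-y b∈U b≢i)) (remove-⊆ U i)))

  data Member (i : Fin n) (𝓕 : Family n) (G : Subset n) : Set where
    kept    : G ∈ᶠ 𝓕 → (i ∈ G → G - i ∈ᶠ 𝓕) → Member i 𝓕 G
    created : ¬ (G ∈ᶠ 𝓕) → Below (dFam i 𝓕) G → Member i 𝓕 G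

  member : ∀ i 𝓕 G → SimplyRooted 𝓕 → G ∈ᶠ dFam i 𝓕 → Member i 𝓕 G
  member i 𝓕 G rooted G∈ with dFam-elim i 𝓕 G G∈
  ... | U , U∈𝓕 , refl with stepView i 𝓕 U
  ... | stays keep U↦U = subst (Member i 𝓕) (sym U↦U) (kept U∈𝓕 keep)
  ... | drops i∈U U-i∉𝓕 U↦U-i =
    subst (Member i 𝓕) (sym U↦U-i)
      (created U-i∉𝓕 (interval-below-step i 𝓕 U i∈U (dropped-root 𝓕 U i rooted U∈𝓕 i∈U U-i∉𝓕)))

  -- A set kept by d_i still has a root in d_i(𝓕).  If its root b in 𝓕 differs
  -- from i this is interval-step; if b = i, a root of U ∖ {i} (or i itself when
  -- U = {i}) serves.
  kept-root : ∀ i 𝓕 U → SimplyRooted 𝓕 → U ∈ᶠ 𝓕 → (i ∈ U → U - i ∈ᶠ 𝓕) → Nonempty U →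
    ∃[ b ] (b ∈ U × Interval (dFam i 𝓕) b U)
  kept-root i 𝓕 U rooted U∈𝓕 keep U-nonempty with rooted U U∈𝓕 U-nonempty
  ... | b , b∈U , interval with b ≟ i
  ...   | no  b≢i = b , b∈U , interval-step i b 𝓕 U (λ i≡b → b≢i (sym i≡b)) interval
  ...   | yes refl with nonempty? (U - i)
  ...     | no  U-i-empty = i , b∈U , singleton-root
    where
    -- here U = {i}, so every C with i ∈ C ⊆ U has C ∖ {i} = U ∖ {i} ∈ 𝓕
    singleton-root : Interval (dFam i 𝓕) i U
    singleton-root C i⊆C C⊆U = stays-in i 𝓕 C (interval C i⊆C C⊆U) (λ _ → subst (_∈ᶠ 𝓕) U-i≡C-i (keep b∈U))
      where
      U-i≡C-i : U - i ≡ C - i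
      U-i≡C-i = trans (Empty-unique U-i-empty)
                      (sym (Empty-unique (λ { (y , y∈C-i) → U-i-empty (y , remove-mono i C⊆U y∈C-i) })))
  ...     | yes U-i-nonempty with rooted (U - i) (keep b∈U) U-i-nonempty
  ...       | c , c∈U-i , interval′ = c , remove-⊆ U i c∈U-i , shared-root
    where
    -- sets containing i are kept because their trace on U ∖ {i} lies in [{c}, U ∖ {i}]
    shared-root : Interval (dFam i 𝓕) c U
    shared-root C c⊆C C⊆U with i ∈? C
    ... | yes i∈C = stays-in i 𝓕 C (interval C (∈⇒⁅⁆⊆ i∈C) C⊆U)
                      (λ _ → interval′ (C - i) c⊆C-i (remove-mono i C⊆U))
      where
      c⊆C-i : ⁅ c ⁆ ⊆ C - i
      c⊆C-i = ∈⇒⁅⁆⊆ (x∈p∧x≢y⇒x∈p-y (⁅⁆⊆⇒∈ c⊆C) (removed-≢ c∈U-i))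
    ... | no  i∉C = stays-in i 𝓕 C (interval′ C c⊆C (⊆-remove C⊆U i∉C)) (λ i∈C → ⊥-elim (i∉C i∈C))

  simplyRooted-step : ∀ i 𝓕 → SimplyRooted 𝓕 → SimplyRooted (dFam i 𝓕)
  simplyRooted-step i 𝓕 rooted G G∈ (x , x∈G) with member i 𝓕 G rooted G∈
  ... | kept G∈𝓕 keep   = kept-root i 𝓕 G rooted G∈𝓕 keep (x , x∈G)
  ... | created _ below = x , x∈G , (λ C _ C⊆G → below C C⊆G)

  absent-step : ∀ i 𝓕 G → SimplyRooted 𝓕 → ¬ (G ∈ᶠ 𝓕) → ¬ (G ∈ᶠ dFam i 𝓕) ⊎ Below (dFam i 𝓕) G
  absent-step i 𝓕 G rooted G∉𝓕 with T? (dFam i 𝓕 G)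
  ... | no  G∉ = inj₁ G∉
  ... | yes G∈ with member i 𝓕 G rooted G∈
  ...   | kept G∈𝓕 _     = ⊥-elim (G∉𝓕 G∈𝓕)
  ...   | created _ below = inj₂ below

module _ {n : ℕ} where

  dEltSeq-intro : ∀ is 𝓕 (S : Subset n) → S ∈ᶠ 𝓕 → dEltSeq is 𝓕 S ∈ᶠ dFamSeq is 𝓕
  dEltSeq-intro []       𝓕 S S∈𝓕 = S∈𝓕
  dEltSeq-intro (i ∷ is) 𝓕 S S∈𝓕 = dEltSeq-intro is (dFam i 𝓕) (dElt i 𝓕 S) (dFam-intro i 𝓕 S S∈𝓕)

  dEltSeq-injective : ∀ is 𝓕 (X Y : Subset n) → X ∈ᶠ 𝓕 → Y ∈ᶠ 𝓕 →
    dEltSeq is 𝓕 X ≡ dEltSeq is 𝓕 Y → X ≡ Y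
  dEltSeq-injective []       𝓕 X Y _   _   eq = eq
  dEltSeq-injective (i ∷ is) 𝓕 X Y X∈𝓕 Y∈𝓕 eq =
    dElt-injective i 𝓕 X Y X∈𝓕 Y∈𝓕
      (dEltSeq-injective is (dFam i 𝓕) _ _ (dFam-intro i 𝓕 X X∈𝓕) (dFam-intro i 𝓕 Y Y∈𝓕) eq)

  -- Compressions do not increase the size of a family (d_i(𝓕) is an image of 𝓕).
  card-dFam≤ : ∀ i (𝓕 : Family n) → card (dFam i 𝓕) ≤ card 𝓕
  card-dFam≤ i 𝓕 =
    surjection⇒length≤ (dElt i 𝓕) _ _ (Unique.filter⁺ (λ S → T? (dFam i 𝓕 S)) (allSubsets-unique n)) onto
    where
    onto : ∀ {G} → G ∈ₗ filter (λ S → T? (dFam i 𝓕 S)) (allSubsets n) →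
      ∃[ S ] (S ∈ₗ filter (λ S → T? (𝓕 S)) (allSubsets n) × dElt i 𝓕 S ≡ G)
    onto G∈ with dFam-elim i 𝓕 _ (proj₂ (∈-filter⁻ (λ S → T? (dFam i 𝓕 S)) {xs = allSubsets n} G∈))
    ... | S , S∈𝓕 , S↦G = S , ∈-filter⁺ (λ S → T? (𝓕 S)) (allSubsets-complete S) S∈𝓕 , S↦G

  card-dFamSeq≤ : ∀ is (𝓕 : Family n) → card (dFamSeq is 𝓕) ≤ card 𝓕
  card-dFamSeq≤ []       𝓕 = ≤-refl
  card-dFamSeq≤ (i ∷ is) 𝓕 = ≤-trans (card-dFamSeq≤ is (dFam i 𝓕)) (card-dFam≤ i 𝓕)

  below-fixed : ∀ is 𝓕 (S : Subset n) → Below 𝓕 S → dEltSeq is 𝓕 S ≡ S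
  below-fixed []       𝓕 S _ = refl
  below-fixed (i ∷ is) 𝓕 S below
    rewrite stays-put i 𝓕 S (λ _ → below (S - i) (remove-⊆ S i)) =
    below-fixed is (dFam i 𝓕) S (below-step i 𝓕 S below)

  dropped-fixed : ∀ is z 𝓕 (S : Subset n) → z ∈ S → Interval 𝓕 z S → ¬ (S - z ∈ᶠ 𝓕) →
    dEltSeq (z ∷ is) 𝓕 S ≡ S - z
  dropped-fixed is z 𝓕 S z∈S interval S-z∉𝓕 rewrite drops-i z 𝓕 S z∈S S-z∉𝓕 =
    below-fixed is (dFam z 𝓕) (S - z) (interval-below-step z 𝓕 S z∈S interval)

  interval-mono : ∀ {𝓕₁ 𝓕 z} {S : Subset n} → 𝓕₁ ⊆ᶠ 𝓕 → Interval 𝓕₁ z S → Interval 𝓕 z S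
  interval-mono 𝓕₁⊆𝓕 interval C z⊆C C⊆S = 𝓕₁⊆𝓕 C (interval C z⊆C C⊆S)

  interval-facet : ∀ {𝓕 z i} {S : Subset n} → z ∈ S → i ≢ z → Interval 𝓕 z S → S - i ∈ᶠ 𝓕
  interval-facet {i = i} {S = S} z∈S i≢z interval =
    interval (S - i) (∈⇒⁅⁆⊆ (x∈p∧x≢y⇒x∈p-y z∈S (λ z≡i → i≢z (sym z≡i)))) (remove-⊆ S i)

  interval-below : ∀ {𝓕 z} {S : Subset n} → Interval 𝓕 z S → Below 𝓕 (S - z) → Below 𝓕 S
  interval-below {z = z} interval below C C⊆S with z ∈? C
  ... | yes z∈C = interval C (∈⇒⁅⁆⊆ z∈C) C⊆S
  ... | no  z∉C = below C (⊆-remove C⊆S z∉C)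

  -- Stability lemma.  Let 𝓑₁ ⊆ 𝓑 with 𝓑 simply rooted, z ∈ S and [{z}, S] ⊆ 𝓑₁,
  -- and let S ∖ {z} be either absent from 𝓑 or have its power set in 𝓑.
  -- Then the compressions along `is` either never move S in 𝓑, or move it
  -- to the same place in 𝓑 and in 𝓑₁.  (Steps i ≠ z keep S in both families
  -- and preserve the hypotheses; step z drops z from S in both.)
  stable : ∀ is z 𝓑 𝓑₁ (S : Subset n) → SimplyRooted 𝓑 → 𝓑₁ ⊆ᶠ 𝓑 → z ∈ S → Interval 𝓑₁ z S →
    ¬ (S - z ∈ᶠ 𝓑) ⊎ Below 𝓑 (S - z) →
    dEltSeq is 𝓑 S ≡ S ⊎ dEltSeq is 𝓑₁ S ≡ dEltSeq is 𝓑 S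
  stable is z 𝓑 𝓑₁ S _ 𝓑₁⊆𝓑 _ interval₁ (inj₂ below) =
    inj₁ (below-fixed is 𝓑 S (interval-below (interval-mono 𝓑₁⊆𝓑 interval₁) below))
  stable [] z 𝓑 𝓑₁ S _ _ _ _ (inj₁ _) = inj₁ refl
  stable (i ∷ is) z 𝓑 𝓑₁ S rooted 𝓑₁⊆𝓑 z∈S interval₁ (inj₁ S-z∉𝓑) with i ≟ z
  ... | yes refl = inj₂ (begin
    dEltSeq (i ∷ is) 𝓑₁ S  ≡⟨ dropped-fixed is i 𝓑₁ S z∈S interval₁ (λ S-i∈𝓑₁ → S-z∉𝓑 (𝓑₁⊆𝓑 _ S-i∈𝓑₁)) ⟩
    S - i                  ≡⟨ dropped-fixed is i 𝓑 S z∈S (interval-mono 𝓑₁⊆𝓑 interval₁) S-z∉𝓑 ⟨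
    dEltSeq (i ∷ is) 𝓑 S   ∎)
    where open ≡-Reasoning
  ... | no  i≢z
    rewrite stays-put i 𝓑 S (λ _ → 𝓑₁⊆𝓑 (S - i) (interval-facet z∈S i≢z interval₁))
          | stays-put i 𝓑₁ S (λ _ → interval-facet z∈S i≢z interval₁) =
    stable is z (dFam i 𝓑) (dFam i 𝓑₁) S (simplyRooted-step i 𝓑 rooted) (⊆ᶠ-step i 𝓑₁ 𝓑 𝓑₁⊆𝓑) z∈S
      (interval-step i z 𝓑₁ S i≢z interval₁) (absent-step i 𝓑 (S - z) rooted S-z∉𝓑)

module _ {n : ℕ} where

  _∪ᶠ_ : Family n → Family n → Family n
  (𝓐 ∪ᶠ 𝓒) S = 𝓐 S ∨ 𝓒 S

  ⊆ᶠ-∪ᶠˡ : ∀ 𝓐 𝓒 → 𝓐 ⊆ᶠ 𝓐 ∪ᶠ 𝓒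
  ⊆ᶠ-∪ᶠˡ 𝓐 𝓒 S S∈𝓐 = from T-∨ (inj₁ S∈𝓐)

  ⊆ᶠ-∪ᶠʳ : ∀ 𝓐 𝓒 → 𝓒 ⊆ᶠ 𝓐 ∪ᶠ 𝓒
  ⊆ᶠ-∪ᶠʳ 𝓐 𝓒 S S∈𝓒 = from T-∨ (inj₂ S∈𝓒)

  Good : Family n → Subset n → Set
  Good 𝓑 S = S ∈ᶠ 𝓑 × ¬ BadSet 𝓑 S

  good? : ∀ 𝓑 S → Dec (Good 𝓑 S)
  good? 𝓑 S = T? (𝓑 S) ×-dec ¬? (badSet? 𝓑 S)

  numGood : Family n → ℕ
  numGood 𝓑 = length (filter (good? 𝓑) (allSubsets n))

  card-split : ∀ 𝓑 → card 𝓑 ≡ numBad 𝓑 + numGood 𝓑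
  card-split 𝓑 = count-split 𝓑 (badSet? 𝓑) (λ _ → proj₁) (allSubsets n)

  missing-facet : ∀ 𝓑 (S : Subset n) → ¬ δ⊆ S 𝓑 → ∃[ z ] (z ∈ S × ¬ (S - z ∈ᶠ 𝓑))
  missing-facet 𝓑 S not-δ⊆ with ¬∀⟶∃¬ n _ (λ i → (i ∈? S) →-dec T? (𝓑 (S - i))) not-δ⊆
  ... | z , not-facet with z ∈? S
  ...   | yes z∈S = z , z∈S , (λ S-z∈𝓑 → not-facet (λ _ → S-z∈𝓑))
  ...   | no  z∉S = ⊥-elim (not-facet (λ z∈S → ⊥-elim (z∉S z∈S)))

  -- If S ∈ 𝓑₁ ⊆ 𝓑 has a facet S ∖ {z} ∉ 𝓑 and d_𝓑 moves S, then
  -- d_𝓑(S) = d_𝓑₁(S) ∈ d(𝓑₁): the interval [{z}, S] ⊆ 𝓑₁ feeds the stability lemma.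
  moved-into : ∀ 𝓑 𝓑₁ (S : Subset n) z → SimplyRooted 𝓑 → SimplyRooted 𝓑₁ → 𝓑₁ ⊆ᶠ 𝓑 →
    S ∈ᶠ 𝓑₁ → z ∈ S → ¬ (S - z ∈ᶠ 𝓑) → d[ 𝓑 ] S ≢ S → d[ 𝓑 ] S ∈ᶠ d 𝓑₁
  moved-into 𝓑 𝓑₁ S z rooted rooted₁ 𝓑₁⊆𝓑 S∈𝓑₁ z∈S S-z∉𝓑 moved
    with stable (allFin n) z 𝓑 𝓑₁ S rooted 𝓑₁⊆𝓑 z∈S interval₁ (inj₁ S-z∉𝓑)
    where
    interval₁ : Interval 𝓑₁ z S
    interval₁ = dropped-root 𝓑₁ S z rooted₁ S∈𝓑₁ z∈S (λ S-z∈𝓑₁ → S-z∉𝓑 (𝓑₁⊆𝓑 _ S-z∈𝓑₁))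
  ... | inj₁ fixed = ⊥-elim (moved fixed)
  ... | inj₂ same  = subst (_∈ᶠ d 𝓑₁) same (dEltSeq-intro (allFin n) 𝓑₁ S S∈𝓑₁)

  good-into : ∀ 𝓑 𝓑₁ 𝓑₂ → SimplyRooted 𝓑 → SimplyRooted 𝓑₁ → SimplyRooted 𝓑₂ →
    (∀ S → 𝓑 S ≡ (𝓑₁ ∪ᶠ 𝓑₂) S) → ∀ S → Good 𝓑 S → d[ 𝓑 ] S ∈ᶠ d 𝓑₁ ∪ᶠ d 𝓑₂
  good-into 𝓑 𝓑₁ 𝓑₂ rooted rooted₁ rooted₂ 𝓑≡ S (S∈𝓑 , not-bad) =
    into (missing-facet 𝓑 S (λ δS⊆𝓑 → not-bad (S∈𝓑 , inj₁ δS⊆𝓑))) (to T-∨ (subst T (𝓑≡ S) S∈𝓑))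
    where
    moved : d[ 𝓑 ] S ≢ S
    moved fixed = not-bad (S∈𝓑 , inj₂ fixed)
    𝓑₁⊆𝓑 : 𝓑₁ ⊆ᶠ 𝓑
    𝓑₁⊆𝓑 X X∈𝓑₁ = subst T (sym (𝓑≡ X)) (⊆ᶠ-∪ᶠˡ 𝓑₁ 𝓑₂ X X∈𝓑₁)
    𝓑₂⊆𝓑 : 𝓑₂ ⊆ᶠ 𝓑
    𝓑₂⊆𝓑 X X∈𝓑₂ = subst T (sym (𝓑≡ X)) (⊆ᶠ-∪ᶠʳ 𝓑₁ 𝓑₂ X X∈𝓑₂)
    into : ∃[ z ] (z ∈ S × ¬ (S - z ∈ᶠ 𝓑)) → S ∈ᶠ 𝓑₁ ⊎ S ∈ᶠ 𝓑₂ → d[ 𝓑 ] S ∈ᶠ d 𝓑₁ ∪ᶠ d 𝓑₂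
    into (z , z∈S , S-z∉𝓑) (inj₁ S∈𝓑₁) =
      ⊆ᶠ-∪ᶠˡ (d 𝓑₁) (d 𝓑₂) _ (moved-into 𝓑 𝓑₁ S z rooted rooted₁ 𝓑₁⊆𝓑 S∈𝓑₁ z∈S S-z∉𝓑 moved)
    into (z , z∈S , S-z∉𝓑) (inj₂ S∈𝓑₂) =
      ⊆ᶠ-∪ᶠʳ (d 𝓑₁) (d 𝓑₂) _ (moved-into 𝓑 𝓑₂ S z rooted rooted₂ 𝓑₂⊆𝓑 S∈𝓑₂ z∈S S-z∉𝓑 moved)

  -- d_𝓑 is injective on 𝓑, so the good sets are at most as many as d(𝓑₁) ∪ d(𝓑₂).
  numGood≤ : ∀ 𝓑 𝓑₁ 𝓑₂ → SimplyRooted 𝓑 → SimplyRooted 𝓑₁ → SimplyRooted 𝓑₂ →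
    (∀ S → 𝓑 S ≡ (𝓑₁ ∪ᶠ 𝓑₂) S) → numGood 𝓑 ≤ card (d 𝓑₁ ∪ᶠ d 𝓑₂)
  numGood≤ 𝓑 𝓑₁ 𝓑₂ rooted rooted₁ rooted₂ 𝓑≡ =
    injection⇒length≤ d[ 𝓑 ] goods _ (Unique.filter⁺ (good? 𝓑) (allSubsets-unique n))
      (λ X∈ Y∈ → dEltSeq-injective (allFin n) 𝓑 _ _ (proj₁ (good X∈)) (proj₁ (good Y∈)))
      (λ X∈ → ∈-filter⁺ (λ S → T? ((d 𝓑₁ ∪ᶠ d 𝓑₂) S)) (allSubsets-complete _)
                (good-into 𝓑 𝓑₁ 𝓑₂ rooted rooted₁ rooted₂ 𝓑≡ _ (good X∈)))
    where
    goods : List (Subset n)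
    goods = filter (good? 𝓑) (allSubsets n)
    good : ∀ {X} → X ∈ₗ goods → Good 𝓑 X
    good X∈ = proj₂ (∈-filter⁻ (good? 𝓑) {xs = allSubsets n} X∈)

lemma17 : (n : ℕ) (𝓑 𝓑₁ 𝓑₂ : Family n) →
    SimplyRooted 𝓑 → SimplyRooted 𝓑₁ → SimplyRooted 𝓑₂ →
    (∀ S → 𝓑 S ≡ 𝓑₁ S ∨ 𝓑₂ S) →
    card (d 𝓑₁ ∩ᶠ d 𝓑₂) ≤ numBad 𝓑 + card (𝓑₁ ∩ᶠ 𝓑₂)
lemma17 n 𝓑 𝓑₁ 𝓑₂ rooted rooted₁ rooted₂ 𝓑≡ = +-cancelˡ-≤ u _ _ (begin
  u + card (d 𝓑₁ ∩ᶠ d 𝓑₂)            ≡⟨ count-∨-∧ (d 𝓑₁) (d 𝓑₂) (allSubsets n) ⟩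
  card (d 𝓑₁) + card (d 𝓑₂)          ≤⟨ +-mono-≤ (card-dFamSeq≤ (allFin n) 𝓑₁) (card-dFamSeq≤ (allFin n) 𝓑₂) ⟩
  card 𝓑₁ + card 𝓑₂                  ≡⟨ count-∨-∧ 𝓑₁ 𝓑₂ (allSubsets n) ⟨
  card (𝓑₁ ∪ᶠ 𝓑₂) + i                ≡⟨ cong (_+ i) (count-cong 𝓑 (𝓑₁ ∪ᶠ 𝓑₂) (allSubsets n) 𝓑≡) ⟨
  card 𝓑 + i                          ≡⟨ cong (_+ i) (card-split 𝓑) ⟩
  (b + numGood 𝓑) + i                 ≤⟨ +-monoˡ-≤ i (+-monoʳ-≤ b (numGood≤ 𝓑 𝓑₁ 𝓑₂ rooted rooted₁ rooted₂ 𝓑≡)) ⟩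
  (b + u) + i                         ≡⟨ cong (_+ i) (+-comm b u) ⟩
  (u + b) + i                         ≡⟨ +-assoc u b i ⟩
  u + (b + i)                         ∎)
  where
  open ≤-Reasoning
  u b i : ℕ
  u = card (d 𝓑₁ ∪ᶠ d 𝓑₂)
  b = numBad 𝓑
  i = card (𝓑₁ ∩ᶠ 𝓑₂)
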